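{- There exist two multisets $A$ and $B$, each consisting of $12$ integers, with $A \neq B$, such that $A^{(4)} = B^{(4)}$.
   Context: For a multiset $A=\{a_1,\dots,a_n\}$ of $n$ (not necessarily distinct) numbers and $1\le k\le n$, the multiset of $k$-sums $A^{(k)}$ is the multiset of all sums $a_{i_1}+a_{i_2}+\dots+a_{i_k}$ with $1\le i_1<i_2<\dots<i_k\le n$, each counted with multiplicity (so $A^{(k)}$ has $\binom{n}{k}$ elements). -}

module Defs where

open import Data.Nat using (ℕ; zero; suc)
open import Data.Integer using (ℤ; _+_; 0ℤ)
open import Data.List using (List; []; _∷_; map; _++_)

-- Multisets of integers are represented as lists, compared up to
-- permutation (Data.List.Relation.Binary.Permutation.Propositional._↭_).

-- kSums k A : the list of all sums a_{i_1} + ... + a_{i_k} with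
-- i_1 < ... < i_k, one entry per index subset (so it has (n choose k)
-- entries); as a multiset this is A^(k).
kSums : ℕ → List ℤ → List ℤ
kSums zero    _        = 0ℤ ∷ []
kSums (suc k) []       = []
kSums (suc k) (x ∷ xs) = map (x +_) (kSums k xs) ++ kSums (suc k) xs

{-# OPTIONS --safe #-}
module Submission where

-- Both witnesses are symmetric about 0:
--   A = {±7, ±7, ±4, ±2, ±1, 0, 0},   B = {±8, ±5, ±4, ±3, ±2, ±1}.

open import Defs
open import Data.Integer using (ℤ; +_; -[1+_]; _≟_)
open import Data.Integer.Properties using (≤-decTotalOrder)
open import Data.List using (List; length; []; _∷_)
open import Data.List.Membership.Propositional using (_∈_; _∉_)
open import Data.List.Membership.DecPropositional _≟_ using (_∈?_)
open import Data.List.Relation.Binary.Permutation.Propositional using (_↭_; ↭-sym; ↭-trans)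
open import Data.List.Relation.Binary.Permutation.Propositional.Properties using (∈-resp-↭)
open import Data.List.Sort.MergeSort.Base ≤-decTotalOrder using (sort)
open import Data.List.Sort.MergeSort.Properties ≤-decTotalOrder using (sort-↭)
open import Data.Product using (Σ; _×_; _,_)
open import Relation.Binary.PropositionalEquality using (_≡_; refl; sym; subst)
open import Relation.Nullary using (¬_)
open import Relation.Nullary.Decidable using (from-yes; from-no)

↭-by-sort : {xs ys : List ℤ} → sort xs ≡ sort ys → xs ↭ ys
↭-by-sort {xs} {ys} sorted-eq =
  ↭-trans (↭-sym (sort-↭ xs)) (subst (_↭ ys) (sym sorted-eq) (sort-↭ ys))

¬↭-by-∈ : {x : ℤ} {xs ys : List ℤ} → x ∈ xs → x ∉ ys → ¬ (xs ↭ ys)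
¬↭-by-∈ x∈xs x∉ys xs↭ys = x∉ys (∈-resp-↭ xs↭ys x∈xs)

A : List ℤ
A = -[1+ 6 ] ∷ -[1+ 6 ] ∷ -[1+ 3 ] ∷ -[1+ 1 ] ∷ -[1+ 0 ] ∷ + 0 ∷
    + 0 ∷ + 1 ∷ + 2 ∷ + 4 ∷ + 7 ∷ + 7 ∷ []

B : List ℤ
B = -[1+ 7 ] ∷ -[1+ 4 ] ∷ -[1+ 3 ] ∷ -[1+ 2 ] ∷ -[1+ 1 ] ∷ -[1+ 0 ] ∷
    + 1 ∷ + 2 ∷ + 3 ∷ + 4 ∷ + 5 ∷ + 8 ∷ []

theorem1 : Σ (List ℤ) (λ A → Σ (List ℤ) (λ B →
             length A ≡ 12 × length B ≡ 12 × ¬ (A ↭ B) × (kSums 4 A ↭ kSums 4 B)))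
theorem1 =
  A , B , refl , refl ,
  ¬↭-by-∈ (from-yes (+ 0 ∈? A)) (from-no (+ 0 ∈? B)) ,
  ↭-by-sort refl
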